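{- Let $N$ be a binary normal network on $X$. Let $\{a,b\}$ be a reticulated cherry of $N$ with reticulation leaf $b$, and let $g_b$ be the grandparent of $b$ that is not the parent of $a$. Then: (i) for all $x\in X-\{a,b\}$, $ab|x\in R(N)$; (ii) for all $c\in V_{g_b}$ and $x\in X-(V_{g_b}\cup\{b\})$, $bc|x\in R(N)$ and $ac|b\notin R(N)$; (iii) for all distinct $c,c'\in V_{g_b}$, $bc|c'\notin R(N)$; (iv) for all $c\in V_{g_b}$ and $x\in X-(V_{g_b}\cup\{a,b\})$, $cx|a\in R(N)$ if and only if $bx|a\in R(N)$; (v) if $bx|y\in R(N)$ and $ax|y\notin R(N)$, where $x,y\in X-(V_{g_b}\cup\{a,b\})$, then $cx|y\in R(N)$ for all $c\in V_{g_b}$; (vi) if $N$ has no near reticulations, $c\in V_{g_b}$, and $ac|x\in R(N)$ for all $x\in X-(V_{g_b}\cup\{a,b\})$, then $ax|c\notin R(N)$ and $ax|b\notin R(N)$ for every $x\in X-(V_{g_b}\cup\{a,b\})$.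
   Context: A (rooted) binary phylogenetic network $N$ on a non-empty finite set $X$ is an acyclic directed graph with a unique vertex of in-degree $0$ (the root) of out-degree $2$; $|X|$ vertices of in-degree $1$ and out-degree $0$ (leaves) bijectively labelled by $X$; and every other vertex either of in-degree $1$ and out-degree $2$ (tree vertex) or of in-degree $2$ and out-degree $1$ (reticulation). A rooted triple is a rooted binary phylogenetic tree on three leaves; $xy|z$ denotes the one on $\{x,y,z\}$ with $z$ adjacent to the root. $N$ is tree-child if every non-leaf vertex has a child that is a tree vertex or leaf; a reticulation arc $(u,v)$ is a shortcut if there is another directed path from $u$ to $v$; $N$ is normal if tree-child with no shortcuts. $N$ displays a tree $T$ if some subdigraph of $N$ is, after suppressing in-degree-one out-degree-one vertices, isomorphic to $T$ respecting leaf labels; $R(N)$ is the set of rooted triples displayed by $N$. For leaves $a,b$, $\{a,b\}$ is a reticulated cherry with reticulation leaf $b$ if the parent $p_b$ of $b$ is a reticulation and the parent $p_a$ of $a$ is a parent of $p_b$. A leaf $\ell$ verifies the visibility of a vertex $u$ if every path from the root to $\ell$ passes through $u$; the visibility set $V_u$ is the set of such leaves. Reticulations $u,v$ are near-sibling reticulations if some tree vertex has as its two children $v$ and a tree vertex that is a parent of $u$; near-stack reticulations if the child of $u$ is a tree vertex that is a parent of $v$; $N$ has no near reticulations if it has neither. -}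

module Defs where

open import Data.Nat using (ℕ; zero; suc; _+_)
open import Data.Fin using (Fin)
import Data.Fin as F
open import Data.Bool using (Bool; true; false; if_then_else_)
open import Data.List using (List; []; _∷_; _++_; drop)
open import Data.List.Membership.Propositional using (_∈_)
open import Data.List.Relation.Unary.Unique.Propositional using (Unique)
open import Data.Product using (Σ; ∃; ∃-syntax; _×_; _,_)
open import Data.Sum using (_⊎_)
open import Relation.Binary.PropositionalEquality using (_≡_; _≢_)
open import Relation.Nullary using (¬_)

count : ∀ {k} → (Fin k → Bool) → ℕ
count {zero}  f = 0
count {suc k} f = (if f F.zero then 1 else 0) + count (λ i → f (F.suc i))

-- A finite directed graph (simple: Boolean adjacency) on vertices Fin n,
-- with a distinguished root and a leaf labelling from X = Fin m.
record Network (m : ℕ) : Set where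
  field
    n    : ℕ
    E    : Fin n → Fin n → Bool
    root : Fin n
    leaf : Fin m → Fin n

module _ {m : ℕ} (N : Network m) where
  open Network N

  Arc : Fin n → Fin n → Set
  Arc u v = E u v ≡ true

  indeg : Fin n → ℕ
  indeg v = count (λ u → E u v)

  outdeg : Fin n → ℕ
  outdeg u = count (λ v → E u v)

  data Path : Fin n → Fin n → List (Fin n) → Set where
    trivial : ∀ u → Path u u (u ∷ [])
    step    : ∀ {u v w ps} → Arc u v → Path v w ps → Path u w (u ∷ ps)

  IsTreeVertex : Fin n → Set
  IsTreeVertex v = indeg v ≡ 1 × outdeg v ≡ 2

  IsReticulation : Fin n → Set
  IsReticulation v = indeg v ≡ 2 × outdeg v ≡ 1

  IsLeaf : Fin n → Set
  IsLeaf v = ∃[ x ] leaf x ≡ v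

  record IsBinaryNetwork : Set where
    field
      acyclic     : ∀ u ps → Path u u ps → ps ≡ u ∷ []
      root-indeg  : indeg root ≡ 0
      root-outdeg : outdeg root ≡ 2
      root-unique : ∀ v → indeg v ≡ 0 → v ≡ root
      leaf-inj    : ∀ x y → leaf x ≡ leaf y → x ≡ y
      leaf-deg    : ∀ x → indeg (leaf x) ≡ 1 × outdeg (leaf x) ≡ 0
      leaf-onto   : ∀ v → indeg v ≡ 1 → outdeg v ≡ 0 → IsLeaf v
      other       : ∀ v → v ≢ root → ¬ IsLeaf v → IsTreeVertex v ⊎ IsReticulation v

  TreeChild : Set
  TreeChild = ∀ v → ¬ IsLeaf v → ∃[ c ] (Arc v c × (IsTreeVertex c ⊎ IsLeaf c))

  Shortcut : Fin n → Fin n → Set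
  Shortcut u v = Arc u v × IsReticulation v
               × ∃[ ps ] (Path u v ps × ps ≢ u ∷ v ∷ [])

  record IsNormal : Set where
    field
      binary     : IsBinaryNetwork
      treeChild  : TreeChild
      noShortcut : ∀ u v → ¬ Shortcut u v

  -- N displays the rooted triple xy|z: a subdigraph that is a subdivision of
  -- the triple, given by a root u, an internal vertex w and directed paths
  -- u ⇝ w, w ⇝ x, w ⇝ y, u ⇝ z meeting only at their shared endpoints.
  Displays : Fin m → Fin m → Fin m → Set
  Displays x y z =
    x ≢ y × x ≢ z × y ≢ z ×
    ∃[ u ] ∃[ w ] ∃[ pw ] ∃[ px ] ∃[ py ] ∃[ pz ]
      (u ≢ w × Path u w pw × Path w (leaf x) px × Path w (leaf y) py
       × Path u (leaf z) pz
       × Unique (pw ++ drop 1 px ++ drop 1 py ++ drop 1 pz))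

  -- leaf ℓ verifies the visibility of u  (ℓ ∈ V_u)
  Visible : Fin n → Fin m → Set
  Visible u ℓ = ∀ ps → Path root (leaf ℓ) ps → u ∈ ps

  record ReticulatedCherry (a b : Fin m) : Set where
    field
      pa     : Fin n
      pb     : Fin n
      pa-a   : Arc pa (leaf a)
      pb-b   : Arc pb (leaf b)
      pb-ret : IsReticulation pb
      pa-pb  : Arc pa pb

  NearSibling : Fin n → Fin n → Set
  NearSibling u v = IsReticulation u × IsReticulation v ×
    ∃[ t ] ∃[ s ] (IsTreeVertex t × Arc t v × Arc t s × IsTreeVertex s × Arc s u)

  NearStack : Fin n → Fin n → Set
  NearStack u v = IsReticulation u × IsReticulation v ×
    ∃[ s ] (Arc u s × IsTreeVertex s × Arc s v)

  NoNearReticulations : Set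
  NoNearReticulations = ∀ u v → ¬ NearSibling u v × ¬ NearStack u v

-- Normality fixes the neighbourhood of the cherry: pb has exactly the
-- parents pa and gb, the arc gb → pb is the only path between them, and gb reaches neither pa nor
-- a.  So every arm to b ends in pa → pb → b or in gb → pb → b, and a vertex strictly below gb on a
-- path to a leaf c ∈ V_gb can only be reached through gb.  The positive claims assemble embeddings
-- (forks at pa or gb, tops at the last vertex a root path shares with another, arms gb → pb → b
-- and gb ⇝ c swapped for each other); the negative ones force two arms to meet.  For (vi), with no
-- near reticulations the sibling of pa is a tree vertex or a leaf and so heads a tree path; the
-- hypothesis puts gb on it, and any arm reaching gb must enter that tree path through the single
-- parent of the sibling, which also lies on the arm to a.
module Submission where

open import Defs
open import Data.Bool using (Bool; true; false; if_then_else_)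
open import Data.Empty using (⊥; ⊥-elim)
open import Data.Fin as F using (Fin)
import Data.Fin.Properties as FP
import Data.Bool.Properties as BoolP
open import Data.List using (List; []; _∷_; _++_; drop; length; lookup)
import Data.List.Properties as LP
open import Data.List.Membership.Propositional using (_∈_; _∉_)
open import Data.List.Membership.Propositional.Properties using (∈-++⁺ˡ; ∈-++⁺ʳ; ∈-++⁻; ∈-lookup)
open import Data.List.Relation.Binary.Disjoint.Propositional using (Disjoint)
open import Data.List.Relation.Unary.All as All using (All; []; _∷_)
import Data.List.Relation.Unary.All.Properties as AllP
open import Data.List.Relation.Unary.AllPairs using ([]; _∷_)
open import Data.List.Relation.Unary.Any using (here; there)
open import Data.List.Relation.Unary.Unique.Propositional using (Unique)
import Data.List.Relation.Unary.Unique.Propositional.Properties as UniqueP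
open import Data.Nat using (ℕ; zero; suc; _≤_; _<_; z≤n; s≤s)
import Data.Nat.Properties as NP
open import Data.Product using (∃; ∃₂; _×_; _,_; proj₁; proj₂)
open import Data.Sum using (_⊎_; inj₁; inj₂; [_,_]′)
open import Function using (_∘_)
open import Relation.Binary.PropositionalEquality
  using (_≡_; _≢_; refl; sym; trans; cong; subst)
open import Relation.Nullary using (¬_; Dec; yes; no; does)
open import Relation.Nullary.Decidable using (dec-false; _×-dec_)

remove : ∀ {k} → (Fin k → Bool) → Fin k → Fin k → Bool
remove f i j = if does (j FP.≟ i) then false else f j

remove-true⁻ : ∀ {k} (f : Fin k → Bool) i j → remove f i j ≡ true → f j ≡ true × j ≢ i
remove-true⁻ f i j r with j FP.≟ i
remove-true⁻ f i j () | yes _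
remove-true⁻ f i j r  | no j≢i = r , j≢i

remove-true⁺ : ∀ {k} (f : Fin k → Bool) i j → f j ≡ true → j ≢ i → remove f i j ≡ true
remove-true⁺ f i j fj j≢i rewrite dec-false (j FP.≟ i) j≢i = fj

count-remove : ∀ {k} (f : Fin k → Bool) i → f i ≡ true → count f ≡ suc (count (remove f i))
count-remove {suc k} f F.zero fi rewrite fi = refl
count-remove {suc k} f (F.suc i) fi rewrite count-remove (λ j → f (F.suc j)) i fi =
  NP.+-suc (if f F.zero then 1 else 0) _

count≡suc⇒∃true : ∀ {k} (f : Fin k → Bool) c → count f ≡ suc c → ∃ λ i → f i ≡ true
count≡suc⇒∃true {suc k} f c eq with f F.zero in f0
... | true  = F.zero , f0
... | false with count≡suc⇒∃true (λ j → f (F.suc j)) c eq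
...   | i , fi = F.suc i , fi

count≡0⇒≢true : ∀ {k} (f : Fin k → Bool) i → count f ≡ 0 → f i ≢ true
count≡0⇒≢true f i c≡0 fi with trans (sym (count-remove f i fi)) c≡0
... | ()

count-remove≡ : ∀ {k} (f : Fin k → Bool) i c → f i ≡ true → count f ≡ suc c → count (remove f i) ≡ c
count-remove≡ f i c fi eq = NP.suc-injective (trans (sym (count-remove f i fi)) eq)

count≡1⇒≡ : ∀ {k} (f : Fin k → Bool) i j → count f ≡ 1 → f i ≡ true → f j ≡ true → i ≡ j
count≡1⇒≡ f i j c≡1 fi fj with j FP.≟ i
... | yes j≡i = sym j≡i
... | no j≢i =
  ⊥-elim (count≡0⇒≢true (remove f i) j (count-remove≡ f i 0 fi c≡1) (remove-true⁺ f i j fj j≢i))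

count≡2⇒∃other : ∀ {k} (f : Fin k → Bool) i → count f ≡ 2 → f i ≡ true → ∃ λ j → j ≢ i × f j ≡ true
count≡2⇒∃other f i c≡2 fi with count≡suc⇒∃true (remove f i) 0 (count-remove≡ f i 1 fi c≡2)
... | j , rj with remove-true⁻ f i j rj
...   | fj , j≢i = j , j≢i , fj

count≡2⇒≡⊎≡ : ∀ {k} (f : Fin k → Bool) i j l → count f ≡ 2 → f i ≡ true → f j ≡ true → i ≢ j →
  f l ≡ true → l ≡ i ⊎ l ≡ j
count≡2⇒≡⊎≡ f i j l c≡2 fi fj i≢j fl with l FP.≟ i
... | yes l≡i = inj₁ l≡i
... | no l≢i = inj₂ (count≡1⇒≡ (remove f i) l j (count-remove≡ f i 1 fi c≡2)
                       (remove-true⁺ f i l fl l≢i) (remove-true⁺ f i j fj (λ j≡i → i≢j (sym j≡i))))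

Unique-++⁻ : ∀ {A : Set} (xs : List A) {ys} → Unique (xs ++ ys) → Unique xs × Unique ys × Disjoint xs ys
Unique-++⁻ [] u = [] , u , λ { (() , _) }
Unique-++⁻ (x ∷ xs) (x∉ ∷ u) with Unique-++⁻ xs u
... | uxs , uys , xs#ys = AllP.++⁻ˡ xs x∉ ∷ uxs , uys , x∷xs#ys
  where
  x∷xs#ys : Disjoint (x ∷ xs) _
  x∷xs#ys (here refl , v∈ys) = All.lookup x∉ (∈-++⁺ʳ xs v∈ys) refl
  x∷xs#ys (there v∈xs , v∈ys) = xs#ys (v∈xs , v∈ys)

Unique-lookup-injective : ∀ {A : Set} {xs : List A} → Unique xs → ∀ i j → lookup xs i ≡ lookup xs j → i ≡ j
Unique-lookup-injective (_ ∷ _) F.zero F.zero _ = refl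
Unique-lookup-injective (x∉ ∷ _) F.zero (F.suc j) eq = ⊥-elim (All.lookup x∉ (∈-lookup j) eq)
Unique-lookup-injective (x∉ ∷ _) (F.suc i) F.zero eq = ⊥-elim (All.lookup x∉ (∈-lookup i) (sym eq))
Unique-lookup-injective (_ ∷ u) (F.suc i) (F.suc j) eq = cong F.suc (Unique-lookup-injective u i j eq)

Unique⇒length≤ : ∀ {n} {xs : List (Fin n)} → Unique xs → length xs ≤ n
Unique⇒length≤ {xs = xs} u = FP.injective⇒≤ {f = lookup xs} (Unique-lookup-injective u _ _)

module Paths {m : ℕ} (N : Network m) (binary : IsBinaryNetwork N) where
  open Network N
  open IsBinaryNetwork binary
  open import Data.List.Membership.DecPropositional (FP._≟_ {n}) using (_∈?_)

  private variable
    u v w y : Fin n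
    ps qs : List (Fin n)

  Reachable : Fin n → Fin n → Set
  Reachable u v = ∃ (Path N u v)

  source∈ : Path N u v ps → u ∈ ps
  source∈ (trivial _) = here refl
  source∈ (step _ _) = here refl

  target∈ : Path N u v ps → v ∈ ps
  target∈ (trivial _) = here refl
  target∈ (step _ p) = there (target∈ p)

  path-≡∷tail : Path N u v ps → ps ≡ u ∷ drop 1 ps
  path-≡∷tail (trivial _) = refl
  path-≡∷tail (step _ _) = refl

  tail⊆ : y ∈ drop 1 ps → y ∈ ps
  tail⊆ {ps = _ ∷ _} y∈ = there y∈

  ∈-source⊎tail : Path N u v ps → y ∈ ps → y ≡ u ⊎ y ∈ drop 1 ps
  ∈-source⊎tail p y∈ rewrite path-≡∷tail p with y∈
  ... | here y≡u = inj₁ y≡u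
  ... | there y∈tail = inj₂ y∈tail

  trivial⇒≡ : Path N u v (u ∷ []) → u ≡ v
  trivial⇒≡ (trivial _) = refl

  infixr 5 _++ᵖ_
  _++ᵖ_ : Path N u v ps → Path N v w qs → Path N u w (ps ++ drop 1 qs)
  trivial _ ++ᵖ trivial _ = trivial _
  trivial _ ++ᵖ step a q = step a q
  step a p  ++ᵖ q = step a (p ++ᵖ q)

  infixl 5 _∷ʳᵖ_
  _∷ʳᵖ_ : Path N u v ps → Arc N v w → Path N u w (ps ++ w ∷ [])
  p ∷ʳᵖ a = p ++ᵖ step a (trivial _)

  ∈-tail-++⁻ : Path N u v ps → y ∈ drop 1 (ps ++ qs) → y ∈ drop 1 ps ⊎ y ∈ qs
  ∈-tail-++⁻ {ps = ps} p y∈ rewrite path-≡∷tail p = ∈-++⁻ (drop 1 ps) y∈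

  ∈-route⁻ : ∀ {R} → Path N u v ps → Path N v w qs → y ∈ R ++ drop 1 (ps ++ drop 1 qs) →
    y ∈ R ⊎ y ∈ drop 1 ps ⊎ y ∈ drop 1 qs
  ∈-route⁻ {R = R} p _ y∈ with ∈-++⁻ R y∈
  ... | inj₁ y∈R = inj₁ y∈R
  ... | inj₂ y∈′ = inj₂ (∈-tail-++⁻ p y∈′)

  module Decomposition {rest : List (Fin n)} (p : Path N u v ps) (qs≡ : qs ≡ ps ++ rest) where

    prefix⊆ : y ∈ ps → y ∈ qs
    prefix⊆ y∈ rewrite qs≡ = ∈-++⁺ˡ y∈

    rest⊆ : y ∈ rest → y ∈ qs
    rest⊆ y∈ rewrite qs≡ = ∈-++⁺ʳ ps y∈

    prefix-tail⊆ : y ∈ drop 1 ps → y ∈ drop 1 qs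
    prefix-tail⊆ y∈ rewrite qs≡ | path-≡∷tail p = ∈-++⁺ˡ y∈

    rest⊆tail : y ∈ rest → y ∈ drop 1 qs
    rest⊆tail y∈ rewrite qs≡ | path-≡∷tail p = ∈-++⁺ʳ (drop 1 ps) y∈

    target∈whole : v ∈ qs
    target∈whole = prefix⊆ (target∈ p)

  suffix⊆ : ∀ {ps₁ ps₂} → Path N u y ps₁ → Path N y v ps₂ → qs ≡ ps₁ ++ drop 1 ps₂ →
    w ∈ ps₂ → w ∈ qs
  suffix⊆ p₁ p₂ qs≡ w∈ with ∈-source⊎tail p₂ w∈
  ... | inj₁ refl = Decomposition.prefix⊆ p₁ qs≡ (target∈ p₁)
  ... | inj₂ w∈tail = Decomposition.rest⊆ p₁ qs≡ w∈tail

  split-path : Path N u v ps → y ∈ ps →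
    ∃₂ λ ps₁ ps₂ → Path N u y ps₁ × Path N y v ps₂ × ps ≡ ps₁ ++ drop 1 ps₂
  split-path (trivial _) (here refl) = _ , _ , trivial _ , trivial _ , refl
  split-path (step a p) (here refl) = _ , _ , trivial _ , step a p , refl
  split-path (step {u = u} a p) (there y∈) with split-path p y∈
  ... | ps₁ , ps₂ , p₁ , p₂ , eq = u ∷ ps₁ , ps₂ , step a p₁ , p₂ , cong (u ∷_) eq

  last-arc : Path N u v ps →
    ps ≡ u ∷ [] ⊎ ∃₂ λ p pre → Path N u p pre × Arc N p v × ps ≡ pre ++ v ∷ []
  last-arc (trivial _) = inj₁ refl
  last-arc (step {u = u} a rest) with last-arc rest
  ... | inj₁ refl with trivial⇒≡ rest
  ...   | refl = inj₂ (u , u ∷ [] , trivial u , a , refl)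
  last-arc (step {u = u} a rest) | inj₂ (p , pre , q , a′ , eq) = inj₂ (p , u ∷ pre , step a q , a′ , cong (u ∷_) eq)

  parent-on-path : Path N u v ps → y ∈ drop 1 ps → ∃ λ p → p ∈ ps × Arc N p y
  parent-on-path (step a (trivial _)) (here refl) = _ , here refl , a
  parent-on-path (step a (step _ _)) (here refl) = _ , here refl , a
  parent-on-path (step a p@(step _ _)) (there y∈) with parent-on-path p y∈
  ... | q , q∈ , aq = q , there q∈ , aq

  no-return : Arc N u v → ¬ Path N v u ps
  no-return {u} a p with acyclic u (u ∷ _) (step a p)
  no-return a (trivial _) | ()
  no-return a (step _ _) | ()

  no-loop : ¬ Arc N u u
  no-loop a = no-return a (trivial _)

  path-antisym : Path N u v ps → Path N v u qs → u ≡ v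
  path-antisym (trivial _) _ = refl
  path-antisym (step a p) q = ⊥-elim (no-return a (p ++ᵖ q))

  path-Unique : Path N u v ps → Unique ps
  path-Unique (trivial _) = [] ∷ []
  path-Unique (step a p) = All.tabulate (λ { u∈ refl → arc-source∉ a p u∈ }) ∷ path-Unique p
    where
    arc-source∉ : Arc N u v → Path N v w ps → u ∉ ps
    arc-source∉ a p u∈ with split-path p u∈
    ... | _ , _ , q , _ , _ = no-return a q

  path-split-disjoint : ∀ {ps₁ rest} → Path N u v qs → qs ≡ ps₁ ++ rest → Disjoint ps₁ rest
  path-split-disjoint {ps₁ = ps₁} p qs≡ = proj₂ (proj₂ (Unique-++⁻ ps₁ (subst Unique qs≡ (path-Unique p))))

  source∉tail : Path N u v ps → u ∉ drop 1 ps
  source∉tail p u∈ with path-Unique p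
  ... | u! rewrite path-≡∷tail p with u!
  ...   | u∉ ∷ _ = All.lookup u∉ u∈ refl

  reaches-target : Path N u v ps → y ∈ ps → Reachable y v
  reaches-target p y∈ with split-path p y∈
  ... | _ , _ , _ , y⇝v , _ = _ , y⇝v

  reachable-from-source : Path N u v ps → y ∈ ps → Reachable u y
  reachable-from-source p y∈ with split-path p y∈
  ... | _ , _ , u⇝y , _ , _ = _ , u⇝y

  ancestor∉tail : Reachable y u → Path N u v ps → y ∉ drop 1 ps
  ancestor∉tail (_ , y⇝u) u⇝v y∈ with split-path u⇝v (tail⊆ y∈)
  ... | _ , _ , u⇝y , _ , _ with path-antisym y⇝u u⇝y
  ...   | refl = source∉tail u⇝v y∈

  has-parent : v ≢ root → ∃ λ p → Arc N p v
  has-parent {v} v≢root with indeg N v in eq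
  ... | zero = ⊥-elim (v≢root (root-unique v eq))
  ... | suc c = count≡suc⇒∃true (λ u → E u v) c eq

  private
    climb : ∀ k v → Reachable root v ⊎ ∃₂ λ u ps → Path N u v ps × k < length ps
    climb zero v = inj₂ (v , _ , trivial v , s≤s z≤n)
    climb (suc k) v with climb k v
    ... | inj₁ r = inj₁ r
    ... | inj₂ (u , ps , p , k<) with u FP.≟ root
    ...   | yes refl = inj₁ (ps , p)
    ...   | no u≢root with has-parent u≢root
    ...     | q , a = inj₂ (q , q ∷ ps , step a p , s≤s k<)

  path-length≤ : Path N u v ps → length ps ≤ n
  path-length≤ p = Unique⇒length≤ (path-Unique p)

  -- Climbing n + 1 times through parents would give a path longer than acyclicity allows.
  root-reaches : ∀ v → Reachable root v
  root-reaches v with climb (suc n) v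
  ... | inj₁ r = r
  ... | inj₂ (_ , _ , p , n<) = ⊥-elim (NP.<⇒≱ n< (NP.m≤n⇒m≤1+n (path-length≤ p)))

  AvoidingPath : Fin n → Fin n → ℕ → Fin n → Set
  AvoidingPath g t k s = ∃ λ ps → Path N s t ps × g ∉ ps × length ps ≤ k

  avoiding-path? : ∀ g t k s → Dec (AvoidingPath g t k s)
  avoiding-path? g t zero s = no λ { (_ , trivial _ , _ , ()) ; (_ , step _ _ , _ , ()) }
  avoiding-path? g t (suc k) s with s FP.≟ g
  ... | yes refl = no λ { (_ , p , g∉ , _) → g∉ (source∈ p) }
  ... | no s≢g with s FP.≟ t
  ...   | yes refl = yes (_ , trivial s , (λ { (here g≡s) → s≢g (sym g≡s) }) , s≤s z≤n)
  ...   | no s≢t with FP.any? (λ c → (E s c BoolP.≟ true) ×-dec avoiding-path? g t k c)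
  ...     | yes (c , a , ps , p , g∉ , len) =
              yes (s ∷ ps , step a p , (λ { (here g≡s) → s≢g (sym g≡s) ; (there g∈) → g∉ g∈ }) , s≤s len)
  ...     | no ¬c = no λ { (_ , trivial _ , _ , _) → s≢t refl
                         ; (_ , step {v = c} a p , g∉ , s≤s len) →
                             ¬c (c , a , (_ , p , (λ g∈ → g∉ (there g∈)) , len)) }

  ¬Visible⇒avoiding-path : ∀ {g x} → ¬ Visible N g x → ∃ λ ps → Path N root (leaf x) ps × g ∉ ps
  ¬Visible⇒avoiding-path {g} {x} ¬vis with avoiding-path? g (leaf x) n root
  ... | yes (ps , p , g∉ , _) = ps , p , g∉
  ... | no ¬avoid = ⊥-elim (¬vis λ ps p → g∈ ps p)
    where
    g∈ : ∀ ps → Path N root (leaf x) ps → g ∈ ps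
    g∈ ps p with g ∈? ps
    ... | yes g∈ps = g∈ps
    ... | no g∉ps = ⊥-elim (¬avoid (ps , p , g∉ps , path-length≤ p))

  record LastMeeting (P : List (Fin n)) (v : Fin n) (Q : List (Fin n)) : Set where
    field
      vertex   : Fin n
      suffix   : List (Fin n)
      path     : Path N vertex v suffix
      vertex∈  : vertex ∈ P
      disjoint : Disjoint (drop 1 suffix) P
      ⊆Q       : ∀ {y} → y ∈ suffix → y ∈ Q
      tail⊆Q   : ∀ {y} → y ∈ drop 1 suffix → y ∈ drop 1 Q

  private
    meet : ∀ P → Path N u v qs → LastMeeting P v qs ⊎ All (_∉ P) qs
    meet P (trivial v) with v ∈? P
    ... | yes v∈ = inj₁ (record { vertex = v ; suffix = _ ; path = trivial v ; vertex∈ = v∈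
                                ; disjoint = λ { (() , _) } ; ⊆Q = λ y∈ → y∈ ; tail⊆Q = λ y∈ → y∈ })
    ... | no v∉ = inj₂ (v∉ ∷ [])
    meet P (step {u = r} a p) with meet P p
    ... | inj₁ M = inj₁ (record { vertex = vertex ; suffix = suffix ; path = path ; vertex∈ = vertex∈
                                ; disjoint = disjoint ; ⊆Q = λ y∈ → there (⊆Q y∈)
                                ; tail⊆Q = λ y∈ → ⊆Q (tail⊆ y∈) })
      where open LastMeeting M
    ... | inj₂ p∉ with r ∈? P
    ...   | yes r∈ = inj₁ (record { vertex = r ; suffix = _ ; path = step a p ; vertex∈ = r∈
                                  ; disjoint = λ (y∈ , y∈P) → All.lookup p∉ y∈ y∈P
                                  ; ⊆Q = λ y∈ → y∈ ; tail⊆Q = λ y∈ → y∈ })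
    ...   | no r∉ = inj₂ (r∉ ∷ p∉)

  last-meeting : ∀ P → Path N u v qs → u ∈ P → LastMeeting P v qs
  last-meeting P q u∈P with meet P q
  ... | inj₁ M = M
  ... | inj₂ q∉ = ⊥-elim (All.lookup q∉ (source∈ q) u∈P)

  module _ {x : Fin m} where

    leaf-childless : ¬ Arc N (leaf x) v
    leaf-childless a = count≡0⇒≢true (E (leaf x)) _ (proj₂ (leaf-deg x)) a

    path-from-leaf : Path N (leaf x) v ps → v ≡ leaf x
    path-from-leaf (trivial _) = refl
    path-from-leaf (step a _) = ⊥-elim (leaf-childless a)

    leaf∈path⇒target : Path N u v ps → leaf x ∈ ps → v ≡ leaf x
    leaf∈path⇒target p x∈ with split-path p x∈
    ... | _ , _ , _ , q , _ = path-from-leaf q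

    leaf-parent-unique : ∀ {p q} → Arc N p (leaf x) → Arc N q (leaf x) → p ≡ q
    leaf-parent-unique = count≡1⇒≡ (λ u → E u (leaf x)) _ _ (proj₁ (leaf-deg x))

    leaf≢reticulation : IsReticulation N v → leaf x ≢ v
    leaf≢reticulation ret refl with trans (sym (proj₁ (leaf-deg x))) (proj₁ ret)
    ... | ()

    leaf≢parent : Arc N u w → leaf x ≢ u
    leaf≢parent a refl = leaf-childless a

  leaf-injective : ∀ {x y} → leaf x ≡ leaf y → x ≡ y
  leaf-injective = leaf-inj _ _

  isLeaf? : ∀ v → Dec (IsLeaf N v)
  isLeaf? v = FP.any? (λ x → leaf x FP.≟ v)

module Embeddings {m : ℕ} (N : Network m) (binary : IsBinaryNetwork N) where
  open Network N
  open Paths N binary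

  private variable
    v : Fin n
    ps : List (Fin n)

  -- As in Displays, the lists px, py, pz enter the disjointness conditions without their first
  -- vertex; below, ⁺ marks a list taken whole and pw⁻ the tail of pw.
  record Embedding (x y z : Fin m) : Set where
    field
      x≢y : x ≢ y
      x≢z : x ≢ z
      y≢z : y ≢ z
      {u w} : Fin n
      {pw px py pz} : List (Fin n)
      u≢w : u ≢ w
      u⇝w : Path N u w pw
      w⇝x : Path N w (leaf x) px
      w⇝y : Path N w (leaf y) py
      u⇝z : Path N u (leaf z) pz
      pw#px : Disjoint pw (drop 1 px)
      pw#py : Disjoint pw (drop 1 py)
      pw#pz : Disjoint pw (drop 1 pz)
      px#py : Disjoint (drop 1 px) (drop 1 py)
      px#pz : Disjoint (drop 1 px) (drop 1 pz)
      py#pz : Disjoint (drop 1 py) (drop 1 pz)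

    ¬w⇝u : ¬ Path N w u ps
    ¬w⇝u q = u≢w (path-antisym u⇝w q)

    u∉px : u ∉ px
    u∉px u∈ with split-path w⇝x u∈
    ... | _ , _ , q , _ , _ = ¬w⇝u q

    u∉py : u ∉ py
    u∉py u∈ with split-path w⇝y u∈
    ... | _ , _ , q , _ , _ = ¬w⇝u q

    u≢leaf : ∀ {ℓ} → u ≢ leaf ℓ
    u≢leaf u≡ℓ = u≢w (trans u≡ℓ (sym (path-from-leaf (subst (λ t → Path N t w pw) u≡ℓ u⇝w))))

    px⁺#pz : Disjoint px (drop 1 pz)
    px⁺#pz (y∈x , y∈z) with ∈-source⊎tail w⇝x y∈x
    ... | inj₁ refl = pw#pz (target∈ u⇝w , y∈z)
    ... | inj₂ y∈ = px#pz (y∈ , y∈z)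

    py⁺#pz : Disjoint py (drop 1 pz)
    py⁺#pz (y∈y , y∈z) with ∈-source⊎tail w⇝y y∈y
    ... | inj₁ refl = pw#pz (target∈ u⇝w , y∈z)
    ... | inj₂ y∈ = py#pz (y∈ , y∈z)

    px⁺#pz⁺ : Disjoint px pz
    px⁺#pz⁺ (y∈x , y∈z) with ∈-source⊎tail u⇝z y∈z
    ... | inj₁ refl = u∉px y∈x
    ... | inj₂ y∈ = px⁺#pz (y∈x , y∈)

    py⁺#pz⁺ : Disjoint py pz
    py⁺#pz⁺ (y∈y , y∈z) with ∈-source⊎tail u⇝z y∈z
    ... | inj₁ refl = u∉py y∈y
    ... | inj₂ y∈ = py⁺#pz (y∈y , y∈)

    pw⁻#pz⁺ : Disjoint (drop 1 pw) pz
    pw⁻#pz⁺ (y∈w , y∈z) with ∈-source⊎tail u⇝z y∈z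
    ... | inj₁ refl = source∉tail u⇝w y∈w
    ... | inj₂ y∈ = pw#pz (tail⊆ y∈w , y∈)

  embedding : ∀ {x y z} → Displays N x y z → Embedding x y z
  embedding (x≢y , x≢z , y≢z , _ , _ , pw , px , py , _ , u≢w , u⇝w , w⇝x , w⇝y , u⇝z , unique)
    with Unique-++⁻ pw unique
  ... | _ , unique-x , pw# with Unique-++⁻ (drop 1 px) unique-x
  ...   | _ , unique-y , px# with Unique-++⁻ (drop 1 py) unique-y
  ...     | _ , _ , py# = record
    { x≢y = x≢y ; x≢z = x≢z ; y≢z = y≢z ; u≢w = u≢w
    ; u⇝w = u⇝w ; w⇝x = w⇝x ; w⇝y = w⇝y ; u⇝z = u⇝z
    ; pw#px = λ (v∈ , v∈′) → pw# (v∈ , ∈-++⁺ˡ v∈′)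
    ; pw#py = λ (v∈ , v∈′) → pw# (v∈ , ∈-++⁺ʳ (drop 1 px) (∈-++⁺ˡ v∈′))
    ; pw#pz = λ (v∈ , v∈′) → pw# (v∈ , ∈-++⁺ʳ (drop 1 px) (∈-++⁺ʳ (drop 1 py) v∈′))
    ; px#py = λ (v∈ , v∈′) → px# (v∈ , ∈-++⁺ˡ v∈′)
    ; px#pz = λ (v∈ , v∈′) → px# (v∈ , ∈-++⁺ʳ (drop 1 py) v∈′)
    ; py#pz = py# }

  displays : ∀ {x y z} → Embedding x y z → Displays N x y z
  displays {x} {y} {z} e =
    x≢y , x≢z , y≢z , u , w , pw , px , py , pz , u≢w , u⇝w , w⇝x , w⇝y , u⇝z ,
    UniqueP.++⁺ (path-Unique u⇝w)
      (UniqueP.++⁺ (tail-Unique w⇝x) (UniqueP.++⁺ (tail-Unique w⇝y) (tail-Unique u⇝z) py#pz) px#)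
      pw#
    where
    open Embedding e
    tail-Unique : ∀ {s t qs} → Path N s t qs → Unique (drop 1 qs)
    tail-Unique p = UniqueP.drop⁺ 1 (path-Unique p)
    px# : Disjoint (drop 1 px) (drop 1 py ++ drop 1 pz)
    px# (v∈ , v∈′) with ∈-++⁻ (drop 1 py) v∈′
    ... | inj₁ v∈y = px#py (v∈ , v∈y)
    ... | inj₂ v∈z = px#pz (v∈ , v∈z)
    pw# : Disjoint pw (drop 1 px ++ drop 1 py ++ drop 1 pz)
    pw# (v∈ , v∈′) with ∈-++⁻ (drop 1 px) v∈′
    ... | inj₁ v∈x = pw#px (v∈ , v∈x)
    ... | inj₂ v∈′′ with ∈-++⁻ (drop 1 py) v∈′′
    ...   | inj₁ v∈y = pw#py (v∈ , v∈y)
    ...   | inj₂ v∈z = pw#pz (v∈ , v∈z)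

module TreePaths {m : ℕ} (N : Network m) (binary : IsBinaryNetwork N) (treeChild : TreeChild N) where
  open Network N
  open IsBinaryNetwork binary
  open Paths N binary

  TreePath : Fin n → Fin m → List (Fin n) → Set
  TreePath t x ts = Path N t (leaf x) ts × All (λ y → indeg N y ≡ 1) (drop 1 ts)

  private
    descend : ∀ k v → (∃₂ λ x ts → TreePath v x ts) ⊎ (∃₂ λ w ts → Path N v w ts × k < length ts)
    descend zero v = inj₂ (v , _ , trivial v , s≤s z≤n)
    descend (suc k) v with isLeaf? v
    ... | yes (x , refl) = inj₁ (x , _ , trivial _ , [])
    ... | no ¬leaf with treeChild v ¬leaf
    ...   | c , a , c-tree with descend k c
    ...     | inj₂ (w , ts , p , k<) = inj₂ (w , v ∷ ts , step a p , s≤s k<)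
    ...     | inj₁ (x , ts , p , indeg≡1) =
                inj₁ (x , v ∷ ts , step a p , subst (All _) (sym (path-≡∷tail p)) (indeg≡1-of c-tree ∷ indeg≡1))
      where
      indeg≡1-of : ∀ {c} → IsTreeVertex N c ⊎ IsLeaf N c → indeg N c ≡ 1
      indeg≡1-of (inj₁ tree) = proj₁ tree
      indeg≡1-of (inj₂ (x′ , refl)) = proj₁ (leaf-deg x′)

  tree-path-exists : ∀ v → ∃₂ λ x ts → TreePath v x ts
  tree-path-exists v with descend (suc n) v
  ... | inj₁ tp = tp
  ... | inj₂ (_ , _ , p , n<) = ⊥-elim (NP.<⇒≱ n< (NP.m≤n⇒m≤1+n (path-length≤ p)))

  -- Inner vertices of a tree path have a single parent, so a path can only enter it at its start.
  tree-path-entry : ∀ {t x ts r y qs} → TreePath t x ts → Path N r y qs → y ∈ ts → t ∈ qs ⊎ r ∈ drop 1 ts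
  tree-path-entry (tp , _) (trivial _) y∈ with ∈-source⊎tail tp y∈
  ... | inj₁ refl = inj₁ (here refl)
  ... | inj₂ y∈tail = inj₂ y∈tail
  tree-path-entry (tp , indeg≡1) (step a q) y∈ with tree-path-entry (tp , indeg≡1) q y∈
  ... | inj₁ t∈ = inj₁ (there t∈)
  ... | inj₂ r∈ with parent-on-path tp r∈
  ...   | p , p∈ , a′ with count≡1⇒≡ (λ u → E u _) _ _ (All.lookup indeg≡1 r∈) a a′
  ...     | refl with ∈-source⊎tail tp p∈
  ...       | inj₁ refl = inj₁ (here refl)
  ...       | inj₂ p∈tail = inj₂ p∈tail

module Cherry {m : ℕ} (N : Network m) (normal : IsNormal N) (a b : Fin m) (rc : ReticulatedCherry N a b)
              (gb : Fin (Network.n N)) (gb→pb : Arc N gb (ReticulatedCherry.pb rc))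
              (gb≢pa : gb ≢ ReticulatedCherry.pa rc) where
  open Network N
  open IsNormal normal
  open IsBinaryNetwork binary
  open ReticulatedCherry rc
  open Paths N binary
  open Embeddings N binary

  private variable
    s t y : Fin n
    x : Fin m
    ps : List (Fin n)

  la lb : Fin n
  la = leaf a
  lb = leaf b

  parent-la : Arc N s la → s ≡ pa
  parent-la a = leaf-parent-unique a pa-a

  parent-lb : Arc N s lb → s ≡ pb
  parent-lb a = leaf-parent-unique a pb-b

  leaf≢pa : leaf x ≢ pa
  leaf≢pa = leaf≢parent pa-a

  leaf≢pb : leaf x ≢ pb
  leaf≢pb = leaf≢reticulation pb-ret

  leaf≢gb : leaf x ≢ gb
  leaf≢gb = leaf≢parent gb→pb

  pa≢pb : pa ≢ pb
  pa≢pb refl = no-loop pa-pb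

  gb≢pb : gb ≢ pb
  gb≢pb refl = no-loop gb→pb

  a≢b : a ≢ b
  a≢b refl = pa≢pb (parent-lb pa-a)

  parent-pb : Arc N s pb → s ≡ pa ⊎ s ≡ gb
  parent-pb = count≡2⇒≡⊎≡ (λ u → E u pb) pa gb _ (proj₁ pb-ret) pa-pb gb→pb
                (λ pa≡gb → gb≢pa (sym pa≡gb))

  child-pb : Arc N pb t → t ≡ lb
  child-pb a = count≡1⇒≡ (E pb) _ _ (proj₂ pb-ret) a pb-b

  pa-outdeg : outdeg N pa ≡ 2
  pa-outdeg with pa FP.≟ root
  ... | yes refl = root-outdeg
  ... | no pa≢root with other pa pa≢root (λ (_ , x≡pa) → leaf≢pa x≡pa)
  ...   | inj₁ tree = proj₂ tree
  ...   | inj₂ ret = ⊥-elim (leaf≢pb (count≡1⇒≡ (E pa) _ _ (proj₂ ret) pa-a pa-pb))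

  child-pa : Arc N pa t → t ≡ la ⊎ t ≡ pb
  child-pa = count≡2⇒≡⊎≡ (E pa) la pb _ pa-outdeg pa-a pa-pb leaf≢pb

  pb-descendant : Path N pb t ps → t ≡ pb ⊎ t ≡ lb
  pb-descendant (trivial _) = inj₁ refl
  pb-descendant (step a p) rewrite child-pb a = inj₂ (path-from-leaf p)

  pa-descendant : Path N pa t ps → t ≡ pa ⊎ t ≡ la ⊎ t ≡ pb ⊎ t ≡ lb
  pa-descendant (trivial _) = inj₁ refl
  pa-descendant (step a p) with child-pa a
  ... | inj₁ refl = inj₂ (inj₁ (path-from-leaf p))
  ... | inj₂ refl with pb-descendant p
  ...   | inj₁ t≡pb = inj₂ (inj₂ (inj₁ t≡pb))
  ...   | inj₂ t≡lb = inj₂ (inj₂ (inj₂ t≡lb))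

  pb∈path : Path N s t ps → pb ∈ ps → t ≡ pb ⊎ t ≡ lb
  pb∈path p pb∈ with split-path p pb∈
  ... | _ , _ , _ , q , _ = pb-descendant q

  pa∈path : Path N s t ps → pa ∈ ps → t ≡ pa ⊎ t ≡ la ⊎ t ≡ pb ⊎ t ≡ lb
  pa∈path p pa∈ with split-path p pa∈
  ... | _ , _ , _ , q , _ = pa-descendant q

  module _ (p : Path N s (leaf x) ps) where

    la∉ : x ≢ a → la ∉ ps
    la∉ x≢a la∈ = x≢a (leaf-injective (leaf∈path⇒target p la∈))

    lb∉ : x ≢ b → lb ∉ ps
    lb∉ x≢b lb∈ = x≢b (leaf-injective (leaf∈path⇒target p lb∈))

    pb∉ : x ≢ b → pb ∉ ps
    pb∉ x≢b pb∈ with pb∈path p pb∈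
    ... | inj₁ x≡pb = leaf≢pb x≡pb
    ... | inj₂ x≡b = x≢b (leaf-injective x≡b)

    pb∷lb# : x ≢ b → Disjoint (pb ∷ lb ∷ []) ps
    pb∷lb# x≢b (here refl , pb∈) = pb∉ x≢b pb∈
    pb∷lb# x≢b (there (here refl) , lb∈) = lb∉ x≢b lb∈

    pa∉ : x ≢ a → x ≢ b → pa ∉ ps
    pa∉ x≢a x≢b pa∈ with pa∈path p pa∈
    ... | inj₁ x≡pa = leaf≢pa x≡pa
    ... | inj₂ (inj₁ x≡a) = x≢a (leaf-injective x≡a)
    ... | inj₂ (inj₂ (inj₁ x≡pb)) = leaf≢pb x≡pb
    ... | inj₂ (inj₂ (inj₂ x≡b)) = x≢b (leaf-injective x≡b)

  path-into-la : Path N s la ps → s ≢ la → ∃ λ pre → Path N s pa pre × ps ≡ pre ++ la ∷ []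
  path-into-la p s≢la with last-arc p
  ... | inj₁ refl = ⊥-elim (s≢la (trivial⇒≡ p))
  ... | inj₂ (_ , pre , q , a , eq) rewrite parent-la a = pre , q , eq

  path-into-lb : Path N s lb ps → s ≢ lb → s ≢ pb →
    ∃₂ λ q pre → (q ≡ pa ⊎ q ≡ gb) × Path N s q pre × ps ≡ pre ++ pb ∷ lb ∷ []
  path-into-lb p s≢lb s≢pb with last-arc p
  ... | inj₁ refl = ⊥-elim (s≢lb (trivial⇒≡ p))
  ... | inj₂ (_ , pre , p′ , a , eq) rewrite parent-lb a with last-arc p′
  ...   | inj₁ refl = ⊥-elim (s≢pb (trivial⇒≡ p′))
  ...   | inj₂ (q , pre′ , p′′ , a′ , eq′) =
            q , pre′ , parent-pb a′ , p′′ ,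
            trans eq (trans (cong (_++ lb ∷ []) eq′) (LP.++-assoc pre′ (pb ∷ []) (lb ∷ [])))

  gb⇝pb-vertices : Path N gb pb ps → y ∈ ps → y ≡ gb ⊎ y ≡ pb
  gb⇝pb-vertices {ps} p y∈ with LP.≡-dec FP._≟_ ps (gb ∷ pb ∷ [])
  ... | no ps≢arc = ⊥-elim (noShortcut gb pb (gb→pb , pb-ret , ps , p , ps≢arc))
  ... | yes refl with y∈
  ...   | here y≡gb = inj₁ y≡gb
  ...   | there (here y≡pb) = inj₂ y≡pb

  ¬gb⇝pa : ¬ Path N gb pa ps
  ¬gb⇝pa p with gb⇝pb-vertices (p ∷ʳᵖ pa-pb) (∈-++⁺ˡ (target∈ p))
  ... | inj₁ pa≡gb = gb≢pa (sym pa≡gb)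
  ... | inj₂ pa≡pb = pa≢pb pa≡pb

  ¬gb⇝la : ¬ Path N gb la ps
  ¬gb⇝la p with path-into-la p (λ gb≡la → leaf≢gb (sym gb≡la))
  ... | _ , q , _ = ¬gb⇝pa q

  gb⇝lb-vertices : Path N gb lb ps → y ∈ ps → y ≡ gb ⊎ y ≡ pb ⊎ y ≡ lb
  gb⇝lb-vertices p y∈ with last-arc p
  ... | inj₁ refl = ⊥-elim (leaf≢gb (sym (trivial⇒≡ p)))
  ... | inj₂ (_ , pre , q , a , refl) rewrite parent-lb a with ∈-++⁻ pre y∈
  ...   | inj₂ (here y≡lb) = inj₂ (inj₂ y≡lb)
  ...   | inj₁ y∈pre with gb⇝pb-vertices q y∈pre
  ...     | inj₁ y≡gb = inj₁ y≡gb
  ...     | inj₂ y≡pb = inj₂ (inj₁ y≡pb)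

  visible-reachable : Visible N gb x → Reachable gb (leaf x)
  visible-reachable {x} vis with root-reaches (leaf x)
  ... | R , r⇝x = reaches-target r⇝x (vis R r⇝x)

  gb-on-route : ∀ {R} → Visible N gb x → Path N root s R → Path N s (leaf x) ps → gb ∈ R ⊎ gb ∈ drop 1 ps
  gb-on-route {R = R} vis r⇝u u⇝x = ∈-++⁻ R (vis _ (r⇝u ++ᵖ u⇝x))

  gb-on-route-via : ∀ {R w pw} → Visible N gb x → Path N root s R → Path N s w pw → Path N w (leaf x) ps →
    gb ∈ R ⊎ gb ∈ drop 1 pw ⊎ gb ∈ drop 1 ps
  gb-on-route-via vis r⇝u u⇝w w⇝x = ∈-route⁻ u⇝w w⇝x (vis _ (r⇝u ++ᵖ u⇝w ++ᵖ w⇝x))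

  ¬visible-a : ¬ Visible N gb a
  ¬visible-a vis = ¬gb⇝la (proj₂ (visible-reachable vis))

  ¬visible-b : ¬ Visible N gb b
  ¬visible-b vis with root-reaches pa
  ... | R , r⇝pa with gb-on-route vis r⇝pa (step pa-pb (step pb-b (trivial lb)))
  ...   | inj₁ gb∈R = ¬gb⇝pa (proj₂ (reaches-target r⇝pa gb∈R))
  ...   | inj₂ (here gb≡pb) = gb≢pb gb≡pb
  ...   | inj₂ (there (here gb≡lb)) = leaf≢gb (sym gb≡lb)

  visible⇒≢lb : ∀ {c} → Visible N gb c → leaf c ≢ lb
  visible⇒≢lb vis c≡b = ¬visible-b (subst (Visible N gb) (leaf-injective c≡b) vis)

  visible⇒≢b : ∀ {c} → Visible N gb c → c ≢ b
  visible⇒≢b vis c≡b = ¬visible-b (subst (Visible N gb) c≡b vis)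

  visible≢invisible : ∀ {c} → Visible N gb c → ¬ Visible N gb x → c ≢ x
  visible≢invisible vis ¬vis refl = ¬vis vis

  gb-dominates-inner : ∀ {c C R t} → Visible N gb c → Path N gb (leaf c) C → t ∈ drop 1 C →
    Path N root t R → gb ∈ R
  gb-dominates-inner vis gb⇝c t∈ r⇝t with split-path gb⇝c (tail⊆ t∈)
  ... | _ , _ , gb⇝t , t⇝c , C≡ with gb-on-route vis r⇝t t⇝c
  ...   | inj₁ gb∈R = gb∈R
  ...   | inj₂ gb∈ = ⊥-elim (source∉tail gb⇝c (Decomposition.rest⊆tail gb⇝t C≡ gb∈))

  pa≢root : pa ≢ root
  pa≢root pa≡root with root-reaches gb
  ... | R , r⇝gb with pa-descendant (subst (λ t → Path N t gb R) (sym pa≡root) r⇝gb)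
  ...   | inj₁ gb≡pa = gb≢pa gb≡pa
  ...   | inj₂ (inj₁ gb≡la) = leaf≢gb (sym gb≡la)
  ...   | inj₂ (inj₂ (inj₁ gb≡pb)) = gb≢pb gb≡pb
  ...   | inj₂ (inj₂ (inj₂ gb≡lb)) = leaf≢gb (sym gb≡lb)

  pa-tree : IsTreeVertex N pa
  pa-tree with other pa pa≢root (λ (_ , x≡pa) → leaf≢pa x≡pa)
  ... | inj₁ tree = tree
  ... | inj₂ ret = ⊥-elim (leaf≢pb (count≡1⇒≡ (E pa) _ _ (proj₂ ret) pa-a pa-pb))

  ppa : Fin n
  ppa = proj₁ (has-parent pa≢root)

  ppa→pa : Arc N ppa pa
  ppa→pa = proj₂ (has-parent pa≢root)

  parent-pa : Arc N s pa → s ≡ ppa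
  parent-pa a = count≡1⇒≡ (λ u → E u pa) _ _ (proj₁ pa-tree) a ppa→pa

  ppa≢pa : ppa ≢ pa
  ppa≢pa ppa≡pa = no-loop (subst (λ t → Arc N t pa) ppa≡pa ppa→pa)

  module _ {y z} (e : Embedding a y z) where
    open Embedding e

    private
      y≢a : y ≢ a
      y≢a y≡a = x≢y (sym y≡a)

      a-arm : ∃ λ pre → Path N w pa pre × px ≡ pre ++ la ∷ []
      a-arm = path-into-la w⇝x (λ w≡la → la∉ w⇝y y≢a (subst (_∈ py) w≡la (source∈ w⇝y)))

    pa∈a-arm : pa ∈ px
    pa∈a-arm = Decomposition.target∈whole (proj₁ (proj₂ a-arm)) (proj₂ (proj₂ a-arm))

    ppa∈a-arm : y ≢ b → ppa ∈ px
    ppa∈a-arm y≢b with a-arm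
    ... | pre , w⇝pa , px≡ with ∈-source⊎tail w⇝pa (target∈ w⇝pa)
    ...   | inj₁ pa≡w = ⊥-elim (pa∉ w⇝y y≢a y≢b (subst (_∈ py) (sym pa≡w) (source∈ w⇝y)))
    ...   | inj₂ pa∈pre with parent-on-path w⇝pa pa∈pre
    ...     | _ , p∈pre , p→pa rewrite parent-pa p→pa = Decomposition.prefix⊆ w⇝pa px≡ p∈pre

  gb∈z-arm : ∀ {y} (e : Embedding a y b) → gb ∈ Embedding.pz e
  gb∈z-arm e with path-into-lb u⇝z u≢leaf u≢pb
    where
    open Embedding e
    u≢pb : u ≢ pb
    u≢pb u≡pb with pb-descendant (subst (λ t → Path N t w pw) u≡pb u⇝w)
    ... | inj₁ w≡pb = u≢w (trans u≡pb (sym w≡pb))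
    ... | inj₂ w≡lb = a≢b (leaf-injective (path-from-leaf (subst (λ t → Path N t la px) w≡lb w⇝x)))
  ... | _ , _ , inj₁ refl , u⇝pa , pz≡ =
        ⊥-elim (Embedding.px⁺#pz⁺ e (pa∈a-arm e , Decomposition.target∈whole u⇝pa pz≡))
  ... | _ , _ , inj₂ refl , u⇝gb , pz≡ = Decomposition.target∈whole u⇝gb pz≡

  b-arm : ∀ {x z} (e : Embedding b x z) → x ≢ b →
    ∃₂ λ q pre → (q ≡ pa ⊎ q ≡ gb) × Path N (Embedding.w e) q pre × Embedding.px e ≡ pre ++ pb ∷ lb ∷ []
  b-arm e x≢b = path-into-lb w⇝x (λ w≡lb → w∉ (there (here w≡lb))) (λ w≡pb → w∉ (here w≡pb))
    where
    open Embedding e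
    w∉ : w ∉ pb ∷ lb ∷ []
    w∉ w∈ = pb∷lb# w⇝y x≢b (w∈ , source∈ w⇝y)

  pa⇝a : Path N pa la (pa ∷ la ∷ [])
  pa⇝a = step pa-a (trivial la)

  pb⇝b : Path N pb lb (pb ∷ lb ∷ [])
  pb⇝b = step pb-b (trivial lb)

  -- The fork is pa; the top is the last vertex of a root path to x that lies on a root path to pa.
  ab∣x : x ≢ a → x ≢ b → Displays N a b x
  ab∣x {x} x≢a x≢b with root-reaches pa | root-reaches (leaf x)
  ... | P , r⇝pa | _ , r⇝x with last-meeting P r⇝x (source∈ r⇝pa)
  ... | M with split-path r⇝pa (LastMeeting.vertex∈ M)
  ... | _ , _ , r⇝u , u⇝pa , P≡ = displays (record
    { x≢y = a≢b ; x≢z = λ a≡x → x≢a (sym a≡x) ; y≢z = λ b≡x → x≢b (sym b≡x)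
    ; u≢w = λ { refl → pa∉ path x≢a x≢b (source∈ path) }
    ; u⇝w = u⇝pa ; w⇝x = pa⇝a ; w⇝y = step pa-pb pb⇝b ; u⇝z = path
    ; pw#px = λ { (y∈ , here refl) → leaf≢pa (sym (leaf∈path⇒target u⇝pa y∈)) }
    ; pw#py = λ { (y∈ , here refl) → [ pa≢pb , leaf≢pa ∘ sym ]′ (pb∈path u⇝pa y∈)
                ; (y∈ , there (here refl)) → leaf≢pa (sym (leaf∈path⇒target u⇝pa y∈)) }
    ; pw#pz = λ (y∈ , y∈′) → disjoint (y∈′ , suffix⊆ r⇝u u⇝pa P≡ y∈)
    ; px#py = λ { (here refl , here la≡pb) → leaf≢pb la≡pb
                ; (here refl , there (here la≡lb)) → a≢b (leaf-injective la≡lb) }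
    ; px#pz = λ { (here refl , y∈) → la∉ path x≢a (tail⊆ y∈) }
    ; py#pz = λ (y∈ , y∈′) → pb∷lb# path x≢b (y∈ , tail⊆ y∈′) })
    where open LastMeeting M

  -- The fork is gb; the top is the last vertex of a gb-avoiding root path to x on a root path to gb.
  bc∣x : ∀ {c} → Visible N gb c → ¬ Visible N gb x → x ≢ b → Displays N b c x
  bc∣x {x} {c} vis ¬vis x≢b with ¬Visible⇒avoiding-path ¬vis | root-reaches gb | visible-reachable vis
  ... | Q , r⇝x , gb∉Q | P , r⇝gb | C , gb⇝c with last-meeting P r⇝x (source∈ r⇝gb)
  ... | M with split-path r⇝gb (LastMeeting.vertex∈ M)
  ... | _ , _ , r⇝u , u⇝gb , P≡ = displays (record
    { x≢y = λ b≡c → ¬visible-b (subst (Visible N gb) (sym b≡c) vis)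
    ; x≢z = λ b≡x → x≢b (sym b≡x) ; y≢z = visible≢invisible vis ¬vis
    ; u≢w = λ { refl → gb∉Q (⊆Q (source∈ path)) }
    ; u⇝w = u⇝gb ; w⇝x = step gb→pb pb⇝b ; w⇝y = gb⇝c ; u⇝z = path
    ; pw#px = λ { (y∈ , here refl) → [ gb≢pb , leaf≢gb ∘ sym ]′ (pb∈path u⇝gb y∈)
                ; (y∈ , there (here refl)) → leaf≢gb (sym (leaf∈path⇒target u⇝gb y∈)) }
    ; pw#py = λ (y∈ , y∈′) → ancestor∉tail (reaches-target u⇝gb y∈) gb⇝c y∈′
    ; pw#pz = λ (y∈ , y∈′) → disjoint (y∈′ , suffix⊆ r⇝u u⇝gb P≡ y∈)
    ; px#py = λ { (here refl , y∈) → [ leaf≢pb , visible⇒≢lb vis ]′ (pb∈path gb⇝c (tail⊆ y∈))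
                ; (there (here refl) , y∈) → visible⇒≢lb vis (leaf∈path⇒target gb⇝c (tail⊆ y∈)) }
    ; px#pz = λ (y∈ , y∈′) → pb∷lb# path x≢b (y∈ , tail⊆ y∈′)
    ; py#pz = λ (y∈ , y∈′) → C#Q (y∈ , ⊆Q (tail⊆ y∈′)) })
    where
    open LastMeeting M
    C#Q : Disjoint (drop 1 C) Q
    C#Q (y∈C , y∈Q) with split-path r⇝x y∈Q
    ... | _ , _ , r⇝y , _ , Q≡ =
      gb∉Q (Decomposition.prefix⊆ r⇝y Q≡ (gb-dominates-inner vis gb⇝c y∈C r⇝y))

  ¬ac∣b : ∀ {c} → Visible N gb c → ¬ Displays N a c b
  ¬ac∣b vis D with embedding D
  ... | e with root-reaches (Embedding.u e)
  ...   | _ , r⇝u with gb-on-route-via vis r⇝u (Embedding.u⇝w e) (Embedding.w⇝y e)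
  ...     | inj₁ gb∈R = ¬gb⇝la (proj₂ (reaches-target r⇝u gb∈R) ++ᵖ Embedding.u⇝w e ++ᵖ Embedding.w⇝x e)
  ...     | inj₂ (inj₁ gb∈pw) = Embedding.pw⁻#pz⁺ e (gb∈pw , gb∈z-arm e)
  ...     | inj₂ (inj₂ gb∈py) = Embedding.py⁺#pz⁺ e (tail⊆ gb∈py , gb∈z-arm e)

  ¬bc∣c′ : ∀ {c c′} → Visible N gb c → Visible N gb c′ → ¬ Displays N b c c′
  ¬bc∣c′ {c} vis vis′ D = contradiction
    where
    open Embedding (embedding D)
    gb∉R : ∀ {R} → Path N root u R → gb ∉ R
    gb∉R r⇝u gb∈R with reaches-target r⇝u gb∈R
    ... | _ , gb⇝u with gb⇝lb-vertices ((gb⇝u ++ᵖ u⇝w) ++ᵖ w⇝x) (∈-++⁺ˡ (target∈ (gb⇝u ++ᵖ u⇝w)))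
    ...   | inj₁ w≡gb = ¬w⇝u (subst (λ t → Path N t u _) (sym w≡gb) gb⇝u)
    ...   | inj₂ (inj₁ w≡pb) = [ leaf≢pb , visible⇒≢lb vis ]′
                                  (pb-descendant (subst (λ t → Path N t (leaf c) py) w≡pb w⇝y))
    ...   | inj₂ (inj₂ w≡lb) = visible⇒≢lb vis (path-from-leaf (subst (λ t → Path N t (leaf c) py) w≡lb w⇝y))
    contradiction : ⊥
    contradiction with root-reaches u
    ... | _ , r⇝u with gb-on-route vis′ r⇝u u⇝z
    ...   | inj₁ gb∈R = gb∉R r⇝u gb∈R
    ...   | inj₂ gb∈pz with gb-on-route-via vis r⇝u u⇝w w⇝y
    ...     | inj₁ gb∈R = gb∉R r⇝u gb∈R
    ...     | inj₂ (inj₁ gb∈pw) = pw#pz (tail⊆ gb∈pw , gb∈pz)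
    ...     | inj₂ (inj₂ gb∈py) = py#pz (gb∈py , gb∈pz)

  -- An embedding of bx|z whose b-arm enters pb from gb is turned into one of cx|z by
  -- replacing gb → pb → b with a path gb ⇝ c.
  module Reroute {x z c} (e : Embedding b x z) (vis : Visible N gb c) (c≢x : c ≢ x) (c≢z : c ≢ z)
                 {pre} (w⇝gb : Path N (Embedding.w e) gb pre)
                 (px≡ : Embedding.px e ≡ pre ++ pb ∷ lb ∷ []) where
    open Embedding e

    private
      R C : List (Fin n)
      R = proj₁ (root-reaches u)
      C = proj₁ (visible-reachable vis)

      r⇝u : Path N root u R
      r⇝u = proj₂ (root-reaches u)

      gb⇝c : Path N gb (leaf c) C
      gb⇝c = proj₂ (visible-reachable vis)

      gb∉R : gb ∉ R
      gb∉R gb∈R = u∉px (subst (_∈ px) (path-antisym gb⇝u (u⇝w ++ᵖ w⇝gb))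
                                      (Decomposition.target∈whole w⇝gb px≡))
        where gb⇝u = proj₂ (reaches-target r⇝u gb∈R)

      C#pz : gb ∉ drop 1 pz → Disjoint (drop 1 C) (drop 1 pz)
      C#pz gb∉ (t∈C , t∈z) with split-path u⇝z (tail⊆ t∈z)
      ... | _ , _ , u⇝t , _ , pz≡ with ∈-++⁻ R (gb-dominates-inner vis gb⇝c t∈C (r⇝u ++ᵖ u⇝t))
      ...   | inj₁ gb∈R = gb∉R gb∈R
      ...   | inj₂ gb∈ = gb∉ (Decomposition.prefix-tail⊆ u⇝t pz≡ gb∈)

      below-fork : gb ∈ drop 1 pre → Displays N c x z
      below-fork gb∈pre = displays (record
        { x≢y = c≢x ; x≢z = c≢z ; y≢z = y≢z ; u≢w = u≢w
        ; u⇝w = u⇝w ; w⇝x = w⇝gb ++ᵖ gb⇝c ; w⇝y = w⇝y ; u⇝z = u⇝z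
        ; pw#px = pw#arm ; pw#py = pw#py ; pw#pz = pw#pz
        ; px#py = arm#py ; px#pz = arm#pz ; py#pz = py#pz })
        where
        open Decomposition w⇝gb px≡
        gb∈px : gb ∈ drop 1 px
        gb∈px = prefix-tail⊆ gb∈pre
        pw#arm : Disjoint pw (drop 1 (pre ++ drop 1 C))
        pw#arm (t∈w , t∈arm) with ∈-tail-++⁻ w⇝gb t∈arm
        ... | inj₁ t∈pre = pw#px (t∈w , prefix-tail⊆ t∈pre)
        ... | inj₂ t∈C = ancestor∉tail (reaches-target (u⇝w ++ᵖ w⇝gb) (∈-++⁺ˡ t∈w)) gb⇝c t∈C
        arm#py : Disjoint (drop 1 (pre ++ drop 1 C)) (drop 1 py)
        arm#py (t∈arm , t∈y) with ∈-tail-++⁻ w⇝gb t∈arm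
        ... | inj₁ t∈pre = px#py (prefix-tail⊆ t∈pre , t∈y)
        ... | inj₂ t∈C with split-path w⇝y (tail⊆ t∈y)
        ...   | _ , _ , w⇝t , _ , py≡
                with ∈-route⁻ u⇝w w⇝t (gb-dominates-inner vis gb⇝c t∈C (r⇝u ++ᵖ u⇝w ++ᵖ w⇝t))
        ...     | inj₁ gb∈R = gb∉R gb∈R
        ...     | inj₂ (inj₁ gb∈pw) = pw#px (tail⊆ gb∈pw , gb∈px)
        ...     | inj₂ (inj₂ gb∈) = px#py (gb∈px , Decomposition.prefix-tail⊆ w⇝t py≡ gb∈)
        arm#pz : Disjoint (drop 1 (pre ++ drop 1 C)) (drop 1 pz)
        arm#pz (t∈arm , t∈z) with ∈-tail-++⁻ w⇝gb t∈arm
        ... | inj₁ t∈pre = px#pz (prefix-tail⊆ t∈pre , t∈z)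
        ... | inj₂ t∈C = C#pz (λ gb∈z → px#pz (gb∈px , gb∈z)) (t∈C , t∈z)

      -- With the fork at gb itself, the new fork is where the x-arm leaves the path gb ⇝ c.
      at-fork : gb ≡ w → Displays N c x z
      at-fork gb≡w = from-meeting (last-meeting C gb⇝x (source∈ gb⇝c))
        where
        u⇝gb : Path N u gb pw
        u⇝gb = subst (λ t → Path N u t pw) (sym gb≡w) u⇝w
        gb⇝x : Path N gb (leaf x) py
        gb⇝x = subst (λ t → Path N t (leaf x) py) (sym gb≡w) w⇝y
        gb∉pz : gb ∉ drop 1 pz
        gb∉pz gb∈ = pw#pz (target∈ u⇝gb , gb∈)
        from-meeting : LastMeeting C (leaf x) py → Displays N c x z
        from-meeting M with split-path gb⇝c (LastMeeting.vertex∈ M)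
        ... | c₁ , c₂ , gb⇝w′ , w′⇝c , C≡ = displays (record
          { x≢y = c≢x ; x≢z = c≢z ; y≢z = y≢z
          ; u≢w = λ u≡w′ → ¬w⇝u (subst (λ t → Path N t u c₁) gb≡w
                                        (subst (λ t → Path N gb t c₁) (sym u≡w′) gb⇝w′))
          ; u⇝w = u⇝gb ++ᵖ gb⇝w′ ; w⇝x = w′⇝c ; w⇝y = path ; u⇝z = u⇝z
          ; pw#px = stem#c₂ ; pw#py = stem#suffix ; pw#pz = stem#pz
          ; px#py = λ (t∈c₂ , t∈suffix) → disjoint (t∈suffix , rest⊆ t∈c₂)
          ; px#pz = λ (t∈c₂ , t∈z) → C#pz gb∉pz (rest⊆tail t∈c₂ , t∈z)
          ; py#pz = λ (t∈suffix , t∈z) → py#pz (tail⊆Q t∈suffix , t∈z) })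
          where
          open LastMeeting M
          open Decomposition gb⇝w′ C≡
          stem#c₂ : Disjoint (pw ++ drop 1 c₁) (drop 1 c₂)
          stem#c₂ (t∈ , t∈c₂) with ∈-++⁻ pw t∈
          ... | inj₁ t∈pw = ancestor∉tail (reaches-target u⇝gb t∈pw) gb⇝c (rest⊆tail t∈c₂)
          ... | inj₂ t∈c₁ = path-split-disjoint gb⇝c C≡ (tail⊆ t∈c₁ , t∈c₂)
          stem#suffix : Disjoint (pw ++ drop 1 c₁) (drop 1 suffix)
          stem#suffix (t∈ , t∈suffix) with ∈-++⁻ pw t∈
          ... | inj₁ t∈pw = pw#py (t∈pw , tail⊆Q t∈suffix)
          ... | inj₂ t∈c₁ = disjoint (t∈suffix , prefix⊆ (tail⊆ t∈c₁))
          stem#pz : Disjoint (pw ++ drop 1 c₁) (drop 1 pz)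
          stem#pz (t∈ , t∈z) with ∈-++⁻ pw t∈
          ... | inj₁ t∈pw = pw#pz (t∈pw , t∈z)
          ... | inj₂ t∈c₁ = C#pz gb∉pz (prefix-tail⊆ t∈c₁ , t∈z)

    cx∣z : Displays N c x z
    cx∣z with ∈-source⊎tail w⇝gb (target∈ w⇝gb)
    ... | inj₁ gb≡w = at-fork gb≡w
    ... | inj₂ gb∈pre = below-fork gb∈pre

  -- Since gb lies on the c-arm or the stem of an embedding of cx|a, an arm to b can branch off at gb.
  module _ {c x} (e : Embedding c x a) (x≢a : x ≢ a) (x≢b : x ≢ b) where
    open Embedding e

    bx∣a-via-c-arm : gb ∈ drop 1 px → Displays N b x a
    bx∣a-via-c-arm gb∈px with split-path w⇝x (tail⊆ gb∈px)
    ... | pre , _ , w⇝gb , _ , px≡ = displays (record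
      { x≢y = λ b≡x → x≢b (sym b≡x) ; x≢z = λ b≡a → a≢b (sym b≡a) ; y≢z = x≢a ; u≢w = u≢w
      ; u⇝w = u⇝w ; w⇝x = w⇝gb ++ᵖ step gb→pb pb⇝b ; w⇝y = w⇝y ; u⇝z = u⇝z
      ; pw#px = pw#arm ; pw#py = pw#py ; pw#pz = pw#pz
      ; px#py = arm#py ; px#pz = arm#pz ; py#pz = py#pz })
      where
      open Decomposition w⇝gb px≡
      pw#arm : Disjoint pw (drop 1 (pre ++ pb ∷ lb ∷ []))
      pw#arm (t∈w , t∈arm) with ∈-tail-++⁻ w⇝gb t∈arm
      ... | inj₁ t∈pre = pw#px (t∈w , prefix-tail⊆ t∈pre)
      ... | inj₂ t∈b = pb∷lb# (u⇝w ++ᵖ w⇝y) x≢b (t∈b , ∈-++⁺ˡ t∈w)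
      arm#py : Disjoint (drop 1 (pre ++ pb ∷ lb ∷ [])) (drop 1 py)
      arm#py (t∈arm , t∈y) with ∈-tail-++⁻ w⇝gb t∈arm
      ... | inj₁ t∈pre = px#py (prefix-tail⊆ t∈pre , t∈y)
      ... | inj₂ t∈b = pb∷lb# w⇝y x≢b (t∈b , tail⊆ t∈y)
      arm#pz : Disjoint (drop 1 (pre ++ pb ∷ lb ∷ [])) (drop 1 pz)
      arm#pz (t∈arm , t∈z) with ∈-tail-++⁻ w⇝gb t∈arm
      ... | inj₁ t∈pre = px#pz (prefix-tail⊆ t∈pre , t∈z)
      ... | inj₂ t∈b = pb∷lb# u⇝z a≢b (t∈b , tail⊆ t∈z)

    bx∣a-via-stem : gb ∈ drop 1 pw → Displays N b x a
    bx∣a-via-stem gb∈pw with split-path u⇝w (tail⊆ gb∈pw)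
    ... | stem , rest , u⇝gb , gb⇝w , pw≡ = displays (record
      { x≢y = λ b≡x → x≢b (sym b≡x) ; x≢z = λ b≡a → a≢b (sym b≡a) ; y≢z = x≢a
      ; u≢w = λ { refl → source∉tail u⇝w gb∈pw }
      ; u⇝w = u⇝gb ; w⇝x = step gb→pb pb⇝b ; w⇝y = gb⇝w ++ᵖ w⇝y ; u⇝z = u⇝z
      ; pw#px = λ (t∈ , t∈b) → pb∷lb# (u⇝gb ++ᵖ gb⇝w ++ᵖ w⇝y) x≢b (t∈b , ∈-++⁺ˡ t∈)
      ; pw#py = stem#arm ; pw#pz = λ (t∈ , t∈z) → pw#pz (prefix⊆ t∈ , t∈z)
      ; px#py = λ (t∈b , t∈) → pb∷lb# (gb⇝w ++ᵖ w⇝y) x≢b (t∈b , tail⊆ t∈)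
      ; px#pz = λ (t∈b , t∈z) → pb∷lb# u⇝z a≢b (t∈b , tail⊆ t∈z)
      ; py#pz = arm#pz })
      where
      open Decomposition u⇝gb pw≡
      stem#arm : Disjoint stem (drop 1 (rest ++ drop 1 py))
      stem#arm (t∈ , t∈arm) with ∈-tail-++⁻ gb⇝w t∈arm
      ... | inj₁ t∈w = path-split-disjoint u⇝w pw≡ (t∈ , t∈w)
      ... | inj₂ t∈y = pw#py (prefix⊆ t∈ , t∈y)
      arm#pz : Disjoint (drop 1 (rest ++ drop 1 py)) (drop 1 pz)
      arm#pz (t∈arm , t∈z) with ∈-tail-++⁻ gb⇝w t∈arm
      ... | inj₁ t∈w = pw#pz (rest⊆ t∈w , t∈z)
      ... | inj₂ t∈y = py#pz (t∈y , t∈z)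

  cx∣a⇒bx∣a : ∀ {c} → Visible N gb c → x ≢ a → x ≢ b → Displays N c x a → Displays N b x a
  cx∣a⇒bx∣a vis x≢a x≢b D with embedding D
  ... | e with root-reaches (Embedding.u e)
  ...   | _ , r⇝u with gb-on-route-via vis r⇝u (Embedding.u⇝w e) (Embedding.w⇝x e)
  ...     | inj₁ gb∈R = ⊥-elim (¬gb⇝la (proj₂ (reaches-target r⇝u gb∈R) ++ᵖ Embedding.u⇝z e))
  ...     | inj₂ (inj₁ gb∈pw) = bx∣a-via-stem e x≢a x≢b gb∈pw
  ...     | inj₂ (inj₂ gb∈px) = bx∣a-via-c-arm e x≢a x≢b gb∈px

  bx∣a⇒cx∣a : ∀ {c} → Visible N gb c → ¬ Visible N gb x → x ≢ b → Displays N b x a → Displays N c x a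
  bx∣a⇒cx∣a vis ¬vis x≢b D with embedding D
  ... | e with b-arm e x≢b
  ...   | _ , _ , inj₂ refl , w⇝gb , px≡ =
          Reroute.cx∣z e vis (visible≢invisible vis ¬vis) (visible≢invisible vis ¬visible-a) w⇝gb px≡
  ...   | _ , _ , inj₁ refl , w⇝pa , px≡ with path-into-la (Embedding.u⇝z e) (Embedding.u≢leaf e)
  ...     | _ , u⇝pa , pz≡ = ⊥-elim (Embedding.px⁺#pz⁺ e (Decomposition.target∈whole w⇝pa px≡
                                                         , Decomposition.target∈whole u⇝pa pz≡))

  bx∣y⇒ax∣y⊎cx∣y : ∀ {y} → ¬ Visible N gb x → x ≢ a → x ≢ b → ¬ Visible N gb y → y ≢ a →
    Displays N b x y → Displays N a x y ⊎ (∀ {c} → Visible N gb c → Displays N c x y)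
  bx∣y⇒ax∣y⊎cx∣y {x} ¬vis-x x≢a x≢b ¬vis-y y≢a D with embedding D
  ... | e with b-arm e x≢b
  ...   | _ , _ , inj₂ refl , w⇝gb , px≡ =
          inj₂ λ vis → Reroute.cx∣z e vis (visible≢invisible vis ¬vis-x) (visible≢invisible vis ¬vis-y) w⇝gb px≡
  ...   | _ , pre , inj₁ refl , w⇝pa , px≡ = inj₁ (displays (record
          { x≢y = λ a≡x → x≢a (sym a≡x) ; x≢z = λ a≡y → y≢a (sym a≡y) ; y≢z = y≢z ; u≢w = u≢w
          ; u⇝w = u⇝w ; w⇝x = w⇝pa ∷ʳᵖ pa-a ; w⇝y = w⇝y ; u⇝z = u⇝z
          ; pw#px = pw#arm ; pw#py = pw#py ; pw#pz = pw#pz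
          ; px#py = arm#py ; px#pz = arm#pz ; py#pz = py#pz }))
    where
    open Embedding e
    open Decomposition w⇝pa px≡
    pw#arm : Disjoint pw (drop 1 (pre ++ la ∷ []))
    pw#arm (t∈w , t∈arm) with ∈-tail-++⁻ w⇝pa t∈arm
    ... | inj₁ t∈pre = pw#px (t∈w , prefix-tail⊆ t∈pre)
    ... | inj₂ (here refl) with reaches-target u⇝w t∈w
    ...   | _ , la⇝w = la∉ (la⇝w ++ᵖ w⇝y) x≢a (source∈ (la⇝w ++ᵖ w⇝y))
    arm#py : Disjoint (drop 1 (pre ++ la ∷ [])) (drop 1 py)
    arm#py (t∈arm , t∈y) with ∈-tail-++⁻ w⇝pa t∈arm
    ... | inj₁ t∈pre = px#py (prefix-tail⊆ t∈pre , t∈y)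
    ... | inj₂ (here refl) = la∉ w⇝y x≢a (tail⊆ t∈y)
    arm#pz : Disjoint (drop 1 (pre ++ la ∷ [])) (drop 1 pz)
    arm#pz (t∈arm , t∈z) with ∈-tail-++⁻ w⇝pa t∈arm
    ... | inj₁ t∈pre = px#pz (prefix-tail⊆ t∈pre , t∈z)
    ... | inj₂ (here refl) = la∉ u⇝z y≢a (tail⊆ t∈z)

  module NoNear (noNear : NoNearReticulations N) where
    open TreePaths N binary treeChild
    open import Data.List.Membership.DecPropositional (FP._≟_ {n}) using (_∈?_)

    ppa-not-reticulation : ¬ IsReticulation N ppa
    ppa-not-reticulation ret = proj₂ (noNear ppa pb) (ret , pb-ret , pa , ppa→pa , pa-tree , pa-pb)

    ppa-root⊎tree : ppa ≡ root ⊎ IsTreeVertex N ppa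
    ppa-root⊎tree with ppa FP.≟ root
    ... | yes ppa≡root = inj₁ ppa≡root
    ... | no ppa≢root with other ppa ppa≢root (λ (_ , x≡ppa) → leaf≢parent ppa→pa x≡ppa)
    ...   | inj₁ tree = inj₂ tree
    ...   | inj₂ ret = ⊥-elim (ppa-not-reticulation ret)

    ppa-outdeg : outdeg N ppa ≡ 2
    ppa-outdeg with ppa-root⊎tree
    ... | inj₁ ppa≡root = subst (λ t → outdeg N t ≡ 2) (sym ppa≡root) root-outdeg
    ... | inj₂ tree = proj₂ tree

    sibling : Fin n
    sibling = proj₁ (count≡2⇒∃other (E ppa) pa ppa-outdeg ppa→pa)

    sibling≢pa : sibling ≢ pa
    sibling≢pa = proj₁ (proj₂ (count≡2⇒∃other (E ppa) pa ppa-outdeg ppa→pa))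

    ppa→sibling : Arc N ppa sibling
    ppa→sibling = proj₂ (proj₂ (count≡2⇒∃other (E ppa) pa ppa-outdeg ppa→pa))

    sibling≢la : sibling ≢ la
    sibling≢la s≡la = ppa≢pa (parent-la (subst (Arc N ppa) s≡la ppa→sibling))

    sibling≢pb : sibling ≢ pb
    sibling≢pb s≡pb with parent-pb (subst (Arc N ppa) s≡pb ppa→sibling)
    ... | inj₁ ppa≡pa = ppa≢pa ppa≡pa
    ... | inj₂ ppa≡gb = ¬gb⇝pa (step (subst (λ t → Arc N t pa) ppa≡gb ppa→pa) (trivial pa))

    sibling≢lb : sibling ≢ lb
    sibling≢lb s≡lb with parent-lb (subst (Arc N ppa) s≡lb ppa→sibling)
    ... | ppa≡pb = no-return pa-pb (step (subst (λ t → Arc N t pa) ppa≡pb ppa→pa) (trivial pa))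

    -- The other parent of sibling would descend from pa or sibling, and neither is possible.
    sibling-of-root-child : ppa ≡ root → ¬ IsReticulation N sibling
    sibling-of-root-child ppa≡root ret with count≡2⇒∃other (λ u → E u sibling) ppa (proj₁ ret) ppa→sibling
    ... | p , p≢ppa , p→s with root-reaches p
    ...   | R , r⇝p with subst (λ t → Path N t p R) (sym ppa≡root) r⇝p
    ...     | trivial _ = p≢ppa refl
    ...     | step ppa→r r⇝p′
              with count≡2⇒≡⊎≡ (E ppa) pa sibling _ ppa-outdeg ppa→pa ppa→sibling
                     (λ pa≡s → sibling≢pa (sym pa≡s)) ppa→r
    ...       | inj₂ refl = no-return p→s r⇝p′
    ...       | inj₁ refl with pa-descendant r⇝p′
    ...         | inj₁ refl = [ sibling≢la , sibling≢pb ]′ (child-pa p→s)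
    ...         | inj₂ (inj₁ refl) = leaf-childless p→s
    ...         | inj₂ (inj₂ (inj₁ refl)) = sibling≢lb (child-pb p→s)
    ...         | inj₂ (inj₂ (inj₂ refl)) = leaf-childless p→s

    sibling-not-reticulation : ¬ IsReticulation N sibling
    sibling-not-reticulation ret =
      [ (λ ppa≡root → sibling-of-root-child ppa≡root ret)
      , (λ tree → proj₁ (noNear pb sibling) (pb-ret , ret , ppa , pa , tree , ppa→sibling , ppa→pa , pa-tree , pa-pb))
      ]′ ppa-root⊎tree

    sibling-indeg : indeg N sibling ≡ 1
    sibling-indeg with isLeaf? sibling
    ... | yes (x , x≡s) = subst (λ t → indeg N t ≡ 1) x≡s (proj₁ (leaf-deg x))
    ... | no ¬leaf with sibling FP.≟ root
    ...   | yes s≡root =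
              ⊥-elim (count≡0⇒≢true (λ u → E u root) ppa root-indeg (subst (Arc N ppa) s≡root ppa→sibling))
    ...   | no s≢root with other sibling s≢root ¬leaf
    ...     | inj₁ tree = proj₁ tree
    ...     | inj₂ ret = ⊥-elim (sibling-not-reticulation ret)

    parent-sibling : Arc N s sibling → s ≡ ppa
    parent-sibling a = count≡1⇒≡ (λ u → E u sibling) _ _ sibling-indeg a ppa→sibling

    ¬sibling⇝la : ¬ Path N sibling la ps
    ¬sibling⇝la p with path-into-la p sibling≢la
    ... | _ , s⇝pa , _ with ∈-source⊎tail s⇝pa (target∈ s⇝pa)
    ...   | inj₁ pa≡s = sibling≢pa (sym pa≡s)
    ...   | inj₂ pa∈ with parent-on-path s⇝pa pa∈
    ...     | _ , p∈ , p→pa rewrite parent-pa p→pa with split-path s⇝pa p∈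
    ...       | _ , _ , s⇝ppa , _ , _ = no-return ppa→sibling s⇝ppa

    module _ {y z} (e : Embedding a y z) where
      open Embedding e

      ¬sibling⇝u : ¬ Reachable sibling u
      ¬sibling⇝u (_ , s⇝u) = ¬sibling⇝la (s⇝u ++ᵖ u⇝w ++ᵖ w⇝x)

      -- sibling has the single parent ppa, which lies on the a-arm.
      sibling∉z-arm : y ≢ b → sibling ∉ pz
      sibling∉z-arm y≢b s∈ with ∈-source⊎tail u⇝z s∈
      ... | inj₁ s≡u = ¬sibling⇝u (subst (Reachable sibling) s≡u (_ , trivial sibling))
      ... | inj₂ s∈tail with parent-on-path u⇝z s∈tail
      ...   | _ , p∈ , p→s rewrite parent-sibling p→s = px⁺#pz⁺ (ppa∈a-arm e y≢b , p∈)

    module _ {c} (vis : Visible N gb c)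
             (ac∣x : ∀ x → ¬ Visible N gb x → x ≢ a → x ≢ b → Displays N a c x) where

      private
        x′ : Fin m
        x′ = proj₁ (tree-path-exists sibling)

        TS : List (Fin n)
        TS = proj₁ (proj₂ (tree-path-exists sibling))

        tree-path : TreePath sibling x′ TS
        tree-path = proj₂ (proj₂ (tree-path-exists sibling))

        s⇝x′ : Path N sibling (leaf x′) TS
        s⇝x′ = proj₁ tree-path

      -- Otherwise x′ would be invisible from gb, and ac|x′ would need a path to x′ entering the
      -- tree path below sibling through its single parent ppa.
      gb∈sibling-tree-path : gb ∈ TS
      gb∈sibling-tree-path with gb ∈? TS
      ... | yes gb∈ = gb∈
      ... | no gb∉ = ⊥-elim (¬ac∣x′ (embedding (ac∣x x′ ¬visible-x′ x′≢a x′≢b)))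
        where
        ¬visible-x′ : ¬ Visible N gb x′
        ¬visible-x′ vis′ with root-reaches ppa
        ... | R , r⇝ppa with gb-on-route vis′ (r⇝ppa ∷ʳᵖ ppa→sibling) s⇝x′
        ...   | inj₂ gb∈tail = gb∉ (tail⊆ gb∈tail)
        ...   | inj₁ gb∈ with ∈-++⁻ R gb∈
        ...     | inj₁ gb∈R = ¬gb⇝pa (proj₂ (reaches-target r⇝ppa gb∈R) ∷ʳᵖ ppa→pa)
        ...     | inj₂ (here gb≡s) = gb∉ (subst (_∈ TS) (sym gb≡s) (source∈ s⇝x′))
        x′≢a : x′ ≢ a
        x′≢a x′≡a = ¬sibling⇝la (subst (λ t → Path N sibling (leaf t) TS) x′≡a s⇝x′)
        x′≢b : x′ ≢ b
        x′≢b x′≡b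
          with path-into-lb (subst (λ t → Path N sibling (leaf t) TS) x′≡b s⇝x′) sibling≢lb sibling≢pb
        ... | _ , _ , inj₁ refl , s⇝pa , _ = ¬sibling⇝la (s⇝pa ∷ʳᵖ pa-a)
        ... | _ , _ , inj₂ refl , s⇝gb , TS≡ = gb∉ (Decomposition.target∈whole s⇝gb TS≡)
        ¬ac∣x′ : ¬ Embedding a c x′
        ¬ac∣x′ e′ with root-reaches (Embedding.u e′)
        ... | R , r⇝u with tree-path-entry tree-path (r⇝u ++ᵖ Embedding.u⇝z e′) (target∈ s⇝x′)
        ...   | inj₂ root∈ with trans (sym (All.lookup (proj₂ tree-path) root∈)) root-indeg
        ...     | ()
        ¬ac∣x′ e′ | R , r⇝u | inj₁ s∈ with ∈-++⁻ R s∈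
        ...     | inj₁ s∈R = ¬sibling⇝u e′ (reaches-target r⇝u s∈R)
        ...     | inj₂ s∈pz = sibling∉z-arm e′ (visible⇒≢b vis) (tail⊆ s∈pz)

      gb∉z-arm : ∀ {y z} (e : Embedding a y z) → y ≢ b → gb ∉ Embedding.pz e
      gb∉z-arm e y≢b gb∈ with split-path (Embedding.u⇝z e) gb∈
      ... | _ , _ , u⇝gb , _ , pz≡ with tree-path-entry tree-path u⇝gb gb∈sibling-tree-path
      ...   | inj₁ s∈ = sibling∉z-arm e y≢b (Decomposition.prefix⊆ u⇝gb pz≡ s∈)
      ...   | inj₂ u∈ = ¬sibling⇝u e (reachable-from-source s⇝x′ (tail⊆ u∈))

      ¬ax∣c : x ≢ b → ¬ Displays N a x c
      ¬ax∣c x≢b D with embedding D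
      ... | e with root-reaches (Embedding.u e)
      ...   | _ , r⇝u with gb-on-route vis r⇝u (Embedding.u⇝z e)
      ...     | inj₁ gb∈R = ¬gb⇝la (proj₂ (reaches-target r⇝u gb∈R) ++ᵖ Embedding.u⇝w e ++ᵖ Embedding.w⇝x e)
      ...     | inj₂ gb∈pz = gb∉z-arm e x≢b (tail⊆ gb∈pz)

      ¬ax∣b : x ≢ b → ¬ Displays N a x b
      ¬ax∣b x≢b D = gb∉z-arm e x≢b (gb∈z-arm e)
        where e = embedding D

lemma3p2 : ∀ {m} (N : Network m) → IsNormal N →
    ∀ (a b : Fin m) (rc : ReticulatedCherry N a b) (gb : Fin (Network.n N)) →
    Arc N gb (ReticulatedCherry.pb rc) → gb ≢ ReticulatedCherry.pa rc →
    (∀ x → x ≢ a → x ≢ b → Displays N a b x)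
    × (∀ c x → Visible N gb c → ¬ Visible N gb x → x ≢ b →
         Displays N b c x × ¬ Displays N a c b)
    × (∀ c c′ → Visible N gb c → Visible N gb c′ → c ≢ c′ → ¬ Displays N b c c′)
    × (∀ c x → Visible N gb c → ¬ Visible N gb x → x ≢ a → x ≢ b →
         (Displays N c x a → Displays N b x a) × (Displays N b x a → Displays N c x a))
    × (∀ x y → ¬ Visible N gb x → x ≢ a → x ≢ b → ¬ Visible N gb y → y ≢ a → y ≢ b →
         Displays N b x y → ¬ Displays N a x y → ∀ c → Visible N gb c → Displays N c x y)
    × (NoNearReticulations N → ∀ c → Visible N gb c →
         (∀ x → ¬ Visible N gb x → x ≢ a → x ≢ b → Displays N a c x) →
         ∀ x → ¬ Visible N gb x → x ≢ a → x ≢ b →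
           ¬ Displays N a x c × ¬ Displays N a x b)
lemma3p2 N normal a b rc gb gb→pb gb≢pa =
    (λ _ x≢a x≢b → ab∣x x≢a x≢b)
  , (λ _ _ vis ¬vis x≢b → bc∣x vis ¬vis x≢b , ¬ac∣b vis)
  , (λ _ _ vis vis′ _ → ¬bc∣c′ vis vis′)
  , (λ _ _ vis ¬vis x≢a x≢b → cx∣a⇒bx∣a vis x≢a x≢b , bx∣a⇒cx∣a vis ¬vis x≢b)
  , (λ _ _ ¬vis-x x≢a x≢b ¬vis-y y≢a _ bx∣y ¬ax∣y _ vis →
       [ (λ ax∣y → ⊥-elim (¬ax∣y ax∣y)) , (λ cx∣y → cx∣y vis) ]′
         (bx∣y⇒ax∣y⊎cx∣y ¬vis-x x≢a x≢b ¬vis-y y≢a bx∣y))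
  , (λ noNear _ vis ac∣x _ _ _ x≢b → NoNear.¬ax∣c noNear vis ac∣x x≢b , NoNear.¬ax∣b noNear vis ac∣x x≢b)
  where open Cherry N normal a b rc gb gb→pb gb≢pa
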